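{- Let $k,t$ be integers with $1\leq k\leq t$ and let $d=\binom{2t-2k}{t-k}$. Then $$N((k,k;d),2t)=bc_{d}(I_{2t}(k,k))=bp_{d}(I_{2t}(k,k))=\binom{2t}{t}.$$
   Context: Let $d,n,t,r,w$ be positive integers and $B=\{B_1,\ldots,B_t\}$ a collection of subsets (blocks) of a set $X$ with $|X|=n$. The pair $(X,B)$ is an $(r,w;d)$-CFF$(n,t)$ (cover-free family) if for any $L,M\subseteq[t]$ with $L\cap M=\emptyset$, $|L|=r$, $|M|=w$, we have $|(\bigcap_{l\in L}B_l)\setminus(\bigcup_{m\in M}B_m)|\geq d$. $N((r,w;d),t)$ is the minimum $n$ for which an $(r,w;d)$-CFF$(n,t)$ exists. A biclique of a graph is a complete bipartite subgraph. The $d$-biclique covering number $bc_d(G)$ is the smallest number of bicliques of $G$ such that every edge of $G$ belongs to at least $d$ of them; the $d$-biclique partition number $bp_d(G)$ is the smallest number of bicliques of $G$ such that every edge of $G$ belongs to exactly $d$ of them. The bi-intersection graph $I_n(r,w)$ is the bipartite graph whose vertices are all $w$-subsets and all $r$-subsets of an $n$-element set (as the two sides), a $w$-subset adjacent to an $r$-subset iff they are disjoint. -}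

module Defs where

open import Data.Nat using (ℕ; zero; suc; _+_; _≤_)
open import Data.Bool using (Bool; true; false; _∧_; _∨_; not; if_then_else_)
open import Data.Fin using (Fin)
open import Data.Fin.Subset using (Subset; _∈_; _∉_; _∩_; ⊥; ∣_∣)
open import Data.Vec using (Vec; tabulate; lookup)
open import Data.Product using (Σ; ∃; _×_; _,_)
open import Relation.Binary.PropositionalEquality using (_≡_)

count : ∀ {m} → (Fin m → Bool) → ℕ
count {zero}  f = 0
count {suc m} f = (if f Data.Fin.zero then 1 else 0) + count (λ i → f (Data.Fin.suc i))

allB : ∀ {m} → (Fin m → Bool) → Bool
allB {zero}  f = true
allB {suc m} f = f Data.Fin.zero ∧ allB (λ i → f (Data.Fin.suc i))

anyB : ∀ {m} → (Fin m → Bool) → Bool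
anyB {zero}  f = false
anyB {suc m} f = f Data.Fin.zero ∨ anyB (λ i → f (Data.Fin.suc i))

⋂[_]_ : ∀ {n t} → (Fin t → Subset n) → Subset t → Subset n
⋂[ B ] L = tabulate λ x → allB (λ l → not (lookup L l) ∨ lookup (B l) x)

⋃[_]_ : ∀ {n t} → (Fin t → Subset n) → Subset t → Subset n
⋃[ B ] M = tabulate λ x → anyB (λ m → lookup M m ∧ lookup (B m) x)

_∖_ : ∀ {n} → Subset n → Subset n → Subset n
A ∖ C = tabulate λ x → lookup A x ∧ not (lookup C x)

IsCFF : (r w d n t : ℕ) → (Fin t → Subset n) → Set
IsCFF r w d n t B =
  (L M : Subset t) → L ∩ M ≡ ⊥ → ∣ L ∣ ≡ r → ∣ M ∣ ≡ w →
  d ≤ ∣ (⋂[ B ] L) ∖ (⋃[ B ] M) ∣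

CFFExists : (r w d n t : ℕ) → Set
CFFExists r w d n t = Σ (Fin t → Subset n) (IsCFF r w d n t)

IsMinimum : (ℕ → Set) → ℕ → Set
IsMinimum P m = P m × (∀ n → P n → m ≤ n)

record BipartiteGraph : Set₁ where
  field
    V₁  : Set
    V₂  : Set
    Adj : V₁ → V₂ → Set

open BipartiteGraph public

record Biclique (G : BipartiteGraph) : Set where
  field
    S        : V₁ G → Bool
    T        : V₂ G → Bool
    S-nonempty : ∃ λ u → S u ≡ true
    T-nonempty : ∃ λ v → T v ≡ true
    complete : ∀ u v → S u ≡ true → T v ≡ true → Adj G u v

open Biclique public

multiplicity : ∀ {G m} → (Fin m → Biclique G) → V₁ G → V₂ G → ℕ
multiplicity ℬ u v = count λ i → S (ℬ i) u ∧ T (ℬ i) v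

IsDBicliqueCover : (d : ℕ) (G : BipartiteGraph) (m : ℕ) → Set
IsDBicliqueCover d G m =
  Σ (Fin m → Biclique G) λ ℬ → ∀ u v → Adj G u v → d ≤ multiplicity ℬ u v

IsDBicliquePartition : (d : ℕ) (G : BipartiteGraph) (m : ℕ) → Set
IsDBicliquePartition d G m =
  Σ (Fin m → Biclique G) λ ℬ → ∀ u v → Adj G u v → multiplicity ℬ u v ≡ d

bc[_]_≡_ : ℕ → BipartiteGraph → ℕ → Set
bc[ d ] G ≡ m = IsMinimum (IsDBicliqueCover d G) m

bp[_]_≡_ : ℕ → BipartiteGraph → ℕ → Set
bp[ d ] G ≡ m = IsMinimum (IsDBicliquePartition d G) m

N[_,_,_]_≡_ : ℕ → ℕ → ℕ → ℕ → ℕ → Set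
N[ r , w , d ] t ≡ m = IsMinimum (λ n → CFFExists r w d n t) m

_-subsets-of_ : ℕ → ℕ → Set
k -subsets-of n = Σ (Subset n) λ A → ∣ A ∣ ≡ k

I : (n r w : ℕ) → BipartiteGraph
I n r w = record
  { V₁  = w -subsets-of n
  ; V₂  = r -subsets-of n
  ; Adj = λ { (A , _) (C , _) → A ∩ C ≡ ⊥ }
  }

-- For t = k + j, index bicliques and points by the halves P of the 2t-set (|P| = t). The biclique of
-- P joins the k-subsets of P to the k-subsets of its complement, and a disjoint pair (A , B) of
-- k-sets lies in exactly the C(2j,j) bicliques with A ⊆ P ⊆ ∁ B; read as an incidence structure
-- with the halves as points, the same family is a (k,k;C(2j,j))-CFF.  Conversely, a CFF and a
-- d-biclique cover both give m possibly empty bicliques covering every edge of I_2t(k,k) d times.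
-- The two sides of such a biclique lie in disjoint ground sets of sizes a + b ≤ 2t, so it has at
-- most C(a,k) C(b,k) ≤ C(t,k)² edges by log-concavity of C(·,k), and double counting the
-- C(2t,k) C(2t-k,k) edges gives m C(t,k)² ≥ C(2j,j) C(2t,k) C(2t-k,k) = C(2t,t) C(t,k)².
module Submission where

open import Defs
open import Data.Bool using (Bool; true; false; _∧_; _∨_; not; if_then_else_)
open import Data.Bool.Properties
  using (∧-zeroʳ; ∧-identityʳ; ∧-conicalˡ; ∧-conicalʳ; T-≡; not-involutive; not-injective)
open import Data.Bool.ListAction using (any)
open import Data.Empty renaming (⊥ to Empty) using (⊥-elim)
open import Data.Fin as Fin using (Fin)
open import Data.Fin.Subset using (Subset; _∩_; _∪_; ∁; ⊥; ∣_∣)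
open import Data.Fin.Subset.Properties using (∣⊥∣≡0; ∣∁p∣≡n∸∣p∣; ∣p∣≤n; ∩-zeroˡ; ∪-identityˡ)
open import Data.List using (List; []; _∷_; _++_; map; length; filterᵇ)
import Data.List as List
open import Data.List.Membership.Propositional using (_∈_; lose)
open import Data.List.Membership.Propositional.Properties using (∈-map⁺; ∈-++⁺ˡ; ∈-++⁺ʳ; ∈-lookup)
import Data.List.Relation.Unary.All as All
open import Data.List.Relation.Unary.All.Properties using (all-filter)
open import Data.List.Relation.Unary.Any using (here; satisfied)
open import Data.List.Relation.Unary.Any.Properties using (any⁺; any⁻)
open import Data.Nat
open import Data.Nat.Properties
open import Data.Nat.Combinatorics
  using (_C_; nCk≡n!/k![n-k]!; k![n∸k]!∣n!; k>n⇒nCk≡0; nCk+nC[k+1]≡[n+1]C[k+1])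
open import Data.Nat.DivMod using (m/n*n≡m)
open import Data.Nat.Tactic.RingSolver using (solve-∀)
open import Data.Product using (_,_; _×_; Σ; ∃; proj₁)
open import Data.Sum using ([_,_]′)
open import Data.Vec using ([]; _∷_; lookup; tabulate)
open import Data.Vec.Properties
  using (∷-injective; lookup-map; lookup∘tabulate; lookup-zipWith; lookup-replicate;
         tabulate-cong; tabulate∘lookup; map-∘; map-cong; map-id)
open import Function.Bundles using (Equivalence)
open import Relation.Binary.PropositionalEquality
open import Relation.Nullary using (yes; no)
open import Relation.Nullary.Negation using (contradiction)

-- Binomial coefficients

[n+1]C[k+1]≡nCk+nC[k+1] : ∀ n k → suc n C suc k ≡ n C k + n C suc k
[n+1]C[k+1]≡nCk+nC[k+1] n k = sym (nCk+nC[k+1]≡[n+1]C[k+1] n k)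

[k+j]Ck*k!*j!≡[k+j]! : ∀ k j → ((k + j) C k) * (k ! * j !) ≡ (k + j) !
[k+j]Ck*k!*j!≡[k+j]! k j =
  subst (λ i → ((k + j) C k) * (k ! * i !) ≡ (k + j) !) (m+n∸m≡n k j) nCk*k![n∸k]!≡n!
  where
  k≤k+j : k ≤ k + j
  k≤k+j = m≤m+n k j
  instance _ = k !* (k + j ∸ k) !≢0
  nCk*k![n∸k]!≡n! : ((k + j) C k) * (k ! * (k + j ∸ k) !) ≡ (k + j) !
  nCk*k![n∸k]!≡n! = trans (cong (_* (k ! * (k + j ∸ k) !)) (nCk≡n!/k![n-k]! k≤k+j)) (m/n*n≡m (k![n∸k]!∣n! k≤k+j))

nC[k+1]*[k+1]≡nCk*[n∸k] : ∀ n k → (n C suc k) * suc k ≡ (n C k) * (n ∸ k)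
nC[k+1]*[k+1]≡nCk*[n∸k] n k with n ≤? k
... | yes n≤k = begin
  (n C suc k) * suc k  ≡⟨ cong (_* suc k) (k>n⇒nCk≡0 (s≤s n≤k)) ⟩
  0                    ≡⟨ *-zeroʳ (n C k) ⟨
  (n C k) * 0          ≡⟨ cong ((n C k) *_) (m≤n⇒m∸n≡0 n≤k) ⟨
  (n C k) * (n ∸ k)    ∎
  where open ≡-Reasoning
... | no n≰k with m≤n⇒∃[o]m+o≡n (≰⇒> n≰k)
... | j , refl = subst (λ n → (n C suc k) * suc k ≡ (n C k) * (n ∸ k)) (+-suc k j)
  (trans at-k+[1+j] (cong (((k + suc j) C k) *_) (sym (m+n∸m≡n k (suc j)))))
  where
  open ≡-Reasoning
  X = (k + suc j) C suc k
  Y = (k + suc j) C k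
  reassocˡ : ∀ x m a b → (x * m) * (a * b) ≡ x * ((m * a) * b)
  reassocˡ = solve-∀
  reassocʳ : ∀ y m a b → y * (a * (m * b)) ≡ (y * m) * (a * b)
  reassocʳ = solve-∀
  at-k+[1+j] : X * suc k ≡ Y * suc j
  at-k+[1+j] = *-cancelʳ-≡ _ _ (k ! * j !) {{k !* j !≢0}} (begin
    (X * suc k) * (k ! * j !)  ≡⟨ reassocˡ X (suc k) (k !) (j !) ⟩
    X * (suc k ! * j !)        ≡⟨ subst (λ n → (n C suc k) * (suc k ! * j !) ≡ n !) (sym (+-suc k j))
                                    ([k+j]Ck*k!*j!≡[k+j]! (suc k) j) ⟩
    (k + suc j) !              ≡⟨ [k+j]Ck*k!*j!≡[k+j]! k (suc j) ⟨
    Y * (k ! * suc j !)        ≡⟨ reassocʳ Y (suc j) (k !) (j !) ⟩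
    (Y * suc j) * (k ! * j !)  ∎)

C-ratio-≤ : ∀ {a c} k → a ≤ c → (a C suc k) * (c C k) ≤ (a C k) * (c C suc k)
C-ratio-≤ {a} {c} k a≤c = *-cancelʳ-≤ _ _ (suc k) (begin
  (a C suc k) * (c C k) * suc k    ≡⟨ swap₂₃ (a C suc k) (c C k) (suc k) ⟩
  (a C suc k) * suc k * (c C k)    ≡⟨ cong (_* (c C k)) (nC[k+1]*[k+1]≡nCk*[n∸k] a k) ⟩
  (a C k) * (a ∸ k) * (c C k)      ≤⟨ *-monoˡ-≤ (c C k) (*-monoʳ-≤ (a C k) (∸-monoˡ-≤ k a≤c)) ⟩
  (a C k) * (c ∸ k) * (c C k)      ≡⟨ swap₂₃ (a C k) (c ∸ k) (c C k) ⟩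
  (a C k) * (c C k) * (c ∸ k)      ≡⟨ *-assoc (a C k) (c C k) (c ∸ k) ⟩
  (a C k) * ((c C k) * (c ∸ k))    ≡⟨ cong ((a C k) *_) (nC[k+1]*[k+1]≡nCk*[n∸k] c k) ⟨
  (a C k) * ((c C suc k) * suc k)  ≡⟨ *-assoc (a C k) (c C suc k) (suc k) ⟨
  (a C k) * (c C suc k) * suc k    ∎)
  where
  open ≤-Reasoning
  swap₂₃ : ∀ x y z → x * y * z ≡ x * z * y
  swap₂₃ = solve-∀

C-exchange-≤ : ∀ {a c} k → a ≤ c → (a C k) * (suc c C k) ≤ (suc a C k) * (c C k)
C-exchange-≤             zero    a≤c = ≤-refl
C-exchange-≤ {a} {c} (suc k) a≤c = begin
  (a C suc k) * (suc c C suc k)                            ≡⟨ cong ((a C suc k) *_) ([n+1]C[k+1]≡nCk+nC[k+1] c k) ⟩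
  (a C suc k) * ((c C k) + (c C suc k))                    ≡⟨ *-distribˡ-+ (a C suc k) (c C k) (c C suc k) ⟩
  (a C suc k) * (c C k) + (a C suc k) * (c C suc k)        ≤⟨ +-monoˡ-≤ _ (C-ratio-≤ k a≤c) ⟩
  (a C k) * (c C suc k) + (a C suc k) * (c C suc k)        ≡⟨ *-distribʳ-+ (c C suc k) (a C k) (a C suc k) ⟨
  ((a C k) + (a C suc k)) * (c C suc k)                    ≡⟨ cong (_* (c C suc k)) ([n+1]C[k+1]≡nCk+nC[k+1] a k) ⟨
  (suc a C suc k) * (c C suc k)                            ∎
  where open ≤-Reasoning

C-balance-≤ : ∀ k s x → (x C k) * ((x + s + s) C k) ≤ ((x + s) C k) * ((x + s) C k)
C-balance-≤ k zero    x =
  ≤-reflexive (cong₂ (λ m n → (m C k) * (n C k)) (sym (+-identityʳ x)) (+-identityʳ (x + 0)))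
C-balance-≤ k (suc s) x = begin
  (x C k) * ((x + suc s + suc s) C k)        ≡⟨ cong (λ n → (x C k) * (n C k)) (+-suc (x + suc s) s) ⟩
  (x C k) * (suc (x + suc s + s) C k)        ≤⟨ C-exchange-≤ k (≤-trans (m≤m+n x (suc s)) (m≤m+n _ s)) ⟩
  (suc x C k) * ((x + suc s + s) C k)        ≡⟨ cong (λ n → (suc x C k) * ((n + s) C k)) (+-suc x s) ⟩
  (suc x C k) * ((suc x + s + s) C k)        ≤⟨ C-balance-≤ k s (suc x) ⟩
  ((suc x + s) C k) * ((suc x + s) C k)      ≡⟨ cong (λ n → (n C k) * (n C k)) (+-suc x s) ⟨
  ((x + suc s) C k) * ((x + suc s) C k)      ∎
  where open ≤-Reasoning

nCk≤[n+1]Ck : ∀ n k → n C k ≤ suc n C k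
nCk≤[n+1]Ck n zero    = ≤-refl
nCk≤[n+1]Ck n (suc k) = ≤-trans (m≤n+m (n C suc k) (n C k)) (≤-reflexive (nCk+nC[k+1]≡[n+1]C[k+1] n k))

C-monoˡ-≤ : ∀ {a b} k → a ≤ b → a C k ≤ b C k
C-monoˡ-≤ k a≤b = go (≤⇒≤′ a≤b)
  where
  go : ∀ {a b} → a ≤′ b → a C k ≤ b C k
  go ≤′-refl        = ≤-refl
  go (≤′-step a≤′b) = ≤-trans (go a≤′b) (nCk≤[n+1]Ck _ k)

0<nCk : ∀ {n k} → k ≤ n → 0 < n C k
0<nCk {n}     {zero}  _         = s≤s z≤n
0<nCk {suc n} {suc k} (s≤s k≤n) =
  ≤-trans (0<nCk k≤n) (≤-trans (m≤m+n (n C k) (n C suc k)) (≤-reflexive (nCk+nC[k+1]≡[n+1]C[k+1] n k)))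

C-product-≤ : ∀ {a b t} k → a + b ≤ t + t → (a C k) * (b C k) ≤ (t C k) * (t C k)
C-product-≤ {a} {b} {t} k a+b≤t+t = [ sorted a+b≤t+t , swapped ]′ (≤-total a b)
  where
  sorted : ∀ {a b} → a + b ≤ t + t → a ≤ b → (a C k) * (b C k) ≤ (t C k) * (t C k)
  sorted {a} {b} a+b≤t+t a≤b = subst (λ t → (a C k) * (b C k) ≤ (t C k) * (t C k)) (m+[n∸m]≡n a≤t) (begin
    (a C k) * (b C k)                  ≤⟨ *-monoʳ-≤ (a C k) (C-monoˡ-≤ k b≤a+s+s) ⟩
    (a C k) * ((a + s + s) C k)        ≤⟨ C-balance-≤ k s a ⟩
    ((a + s) C k) * ((a + s) C k)      ∎)
    where
    open ≤-Reasoning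
    a≤t : a ≤ t
    a≤t = ≮⇒≥ λ t<a → <⇒≱ (+-mono-< t<a t<a) (≤-trans (+-monoʳ-≤ a a≤b) a+b≤t+t)
    s = t ∸ a
    b≤a+s+s : b ≤ a + s + s
    b≤a+s+s = +-cancelˡ-≤ a b (a + s + s) (≤-trans a+b≤t+t (≤-reflexive (begin-equality
      t + t              ≡⟨ cong₂ _+_ t≡a+s t≡a+s ⟩
      (a + s) + (a + s)  ≡⟨ regroup a s ⟩
      a + (a + s + s)    ∎)))
      where
      t≡a+s : t ≡ a + s
      t≡a+s = sym (m+[n∸m]≡n a≤t)
      regroup : ∀ a s → (a + s) + (a + s) ≡ a + (a + s + s)
      regroup = solve-∀
  swapped : b ≤ a → (a C k) * (b C k) ≤ (t C k) * (t C k)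
  swapped b≤a = subst (_≤ (t C k) * (t C k)) (*-comm (b C k) (a C k))
                  (sorted (subst (_≤ t + t) (+-comm a b) a+b≤t+t) b≤a)

-- Both sides equal (t + t)! / (k! j!)², where t = k + j.
C-identity : ∀ k j →
  ((j + j) C j) * (((k + j + (k + j)) C k) * ((k + (j + j)) C k))
  ≡ ((k + j + (k + j)) C (k + j)) * (((k + j) C k) * ((k + j) C k))
C-identity k j = *-cancelʳ-≡ _ _ (k ! * k ! * (j ! * j !)) {{m*n≢0 _ _ {{k !* k !≢0}} {{j !* j !≢0}}}}
  (trans lhs≡[2t]! (sym rhs≡[2t]!))
  where
  open ≡-Reasoning
  t = k + j
  D = (j + j) C j
  B₁ = (t + t) C k
  B₂ = (k + (j + j)) C k
  E = (t + t) C t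
  B = t C k
  k+[k+2j]≡2t : ∀ k j → k + (k + (j + j)) ≡ (k + j) + (k + j)
  k+[k+2j]≡2t = solve-∀
  lhs≡[2t]! : D * (B₁ * B₂) * (k ! * k ! * (j ! * j !)) ≡ (t + t) !
  lhs≡[2t]! = begin
    D * (B₁ * B₂) * (k ! * k ! * (j ! * j !))        ≡⟨ regroup D B₁ B₂ (k !) (j !) ⟩
    B₁ * (k ! * (B₂ * (k ! * (D * (j ! * j !)))))    ≡⟨ cong (λ x → B₁ * (k ! * (B₂ * (k ! * x)))) ([k+j]Ck*k!*j!≡[k+j]! j j) ⟩
    B₁ * (k ! * (B₂ * (k ! * (j + j) !)))            ≡⟨ cong (λ x → B₁ * (k ! * x)) ([k+j]Ck*k!*j!≡[k+j]! k (j + j)) ⟩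
    B₁ * (k ! * (k + (j + j)) !)                     ≡⟨ subst (λ n → (n C k) * (k ! * (k + (j + j)) !) ≡ n !) (k+[k+2j]≡2t k j)
                                                          ([k+j]Ck*k!*j!≡[k+j]! k (k + (j + j))) ⟩
    (t + t) !                                        ∎
    where
    regroup : ∀ d b₁ b₂ x y → d * (b₁ * b₂) * (x * x * (y * y)) ≡ b₁ * (x * (b₂ * (x * (d * (y * y)))))
    regroup = solve-∀
  rhs≡[2t]! : E * (B * B) * (k ! * k ! * (j ! * j !)) ≡ (t + t) !
  rhs≡[2t]! = begin
    E * (B * B) * (k ! * k ! * (j ! * j !))          ≡⟨ regroup E B (k !) (j !) ⟩
    E * ((B * (k ! * j !)) * (B * (k ! * j !)))      ≡⟨ cong (λ x → E * (x * x)) ([k+j]Ck*k!*j!≡[k+j]! k j) ⟩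
    E * (t ! * t !)                                  ≡⟨ [k+j]Ck*k!*j!≡[k+j]! t t ⟩
    (t + t) !                                        ∎
    where
    regroup : ∀ e b x y → e * (b * b) * (x * x * (y * y)) ≡ e * ((b * (x * y)) * (b * (x * y)))
    regroup = solve-∀

-- Finite sums and counts

𝟙 : Bool → ℕ
𝟙 b = if b then 1 else 0

𝟙-∧ : ∀ a b → 𝟙 (a ∧ b) ≡ 𝟙 a * 𝟙 b
𝟙-∧ true  b = sym (+-identityʳ (𝟙 b))
𝟙-∧ false b = refl

module _ {A : Set} where

  sumOver : List A → (A → ℕ) → ℕ
  sumOver []       f = 0
  sumOver (x ∷ xs) f = f x + sumOver xs f

  syntax sumOver xs (λ x → e) = ∑[ x ∈ xs ] e

  ∑-zero : ∀ xs → ∑[ x ∈ xs ] 0 ≡ 0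
  ∑-zero []       = refl
  ∑-zero (x ∷ xs) = ∑-zero xs

  ∑-cong : ∀ xs {f g : A → ℕ} → (∀ x → f x ≡ g x) → ∑[ x ∈ xs ] f x ≡ ∑[ x ∈ xs ] g x
  ∑-cong []       f≗g = refl
  ∑-cong (x ∷ xs) f≗g = cong₂ _+_ (f≗g x) (∑-cong xs f≗g)

  ∑-mono-≤ : ∀ xs {f g : A → ℕ} → (∀ x → f x ≤ g x) → ∑[ x ∈ xs ] f x ≤ ∑[ x ∈ xs ] g x
  ∑-mono-≤ []       f≤g = z≤n
  ∑-mono-≤ (x ∷ xs) f≤g = +-mono-≤ (f≤g x) (∑-mono-≤ xs f≤g)

  ∑-distrib-+ : ∀ xs (f g : A → ℕ) → ∑[ x ∈ xs ] (f x + g x) ≡ ∑[ x ∈ xs ] f x + ∑[ x ∈ xs ] g x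
  ∑-distrib-+ []       f g = refl
  ∑-distrib-+ (x ∷ xs) f g = trans (cong (f x + g x +_) (∑-distrib-+ xs f g)) (interchange (f x) (g x) _ _)
    where
    interchange : ∀ a b c d → a + b + (c + d) ≡ a + c + (b + d)
    interchange = solve-∀

  *-distribˡ-∑ : ∀ c xs (f : A → ℕ) → c * ∑[ x ∈ xs ] f x ≡ ∑[ x ∈ xs ] (c * f x)
  *-distribˡ-∑ c []       f = *-zeroʳ c
  *-distribˡ-∑ c (x ∷ xs) f = trans (*-distribˡ-+ c (f x) _) (cong (c * f x +_) (*-distribˡ-∑ c xs f))

  ∑-++ : ∀ xs ys (f : A → ℕ) → ∑[ x ∈ xs ++ ys ] f x ≡ ∑[ x ∈ xs ] f x + ∑[ x ∈ ys ] f x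
  ∑-++ []       ys f = refl
  ∑-++ (x ∷ xs) ys f = trans (cong (f x +_) (∑-++ xs ys f)) (sym (+-assoc (f x) _ _))

∑-map : ∀ {A B : Set} (g : A → B) xs (f : B → ℕ) → ∑[ y ∈ map g xs ] f y ≡ ∑[ x ∈ xs ] f (g x)
∑-map g []       f = refl
∑-map g (x ∷ xs) f = cong (f (g x) +_) (∑-map g xs f)

∑∑-count-≤ : ∀ {A B : Set} {m c} (xs : List A) (ys : List B) (g : Fin m → A → B → Bool) →
  (∀ i → ∑[ x ∈ xs ] ∑[ y ∈ ys ] 𝟙 (g i x y) ≤ c) →
  ∑[ x ∈ xs ] ∑[ y ∈ ys ] count (λ i → g i x y) ≤ m * c
∑∑-count-≤ {m = zero} xs ys g bound =
  ≤-reflexive (trans (∑-cong xs (λ _ → ∑-zero ys)) (∑-zero xs))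
∑∑-count-≤ {m = suc m} {c} xs ys g bound = begin
  ∑[ x ∈ xs ] ∑[ y ∈ ys ] (𝟙 (g Fin.zero x y) + count (λ i → g (Fin.suc i) x y))
    ≡⟨ ∑-cong xs (λ x → ∑-distrib-+ ys _ _) ⟩
  ∑[ x ∈ xs ] (∑[ y ∈ ys ] 𝟙 (g Fin.zero x y) + ∑[ y ∈ ys ] count (λ i → g (Fin.suc i) x y))
    ≡⟨ ∑-distrib-+ xs _ _ ⟩
  ∑[ x ∈ xs ] ∑[ y ∈ ys ] 𝟙 (g Fin.zero x y) + ∑[ x ∈ xs ] ∑[ y ∈ ys ] count (λ i → g (Fin.suc i) x y)
    ≤⟨ +-mono-≤ (bound Fin.zero) (∑∑-count-≤ xs ys (λ i → g (Fin.suc i)) (λ i → bound (Fin.suc i))) ⟩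
  c + m * c ∎
  where open ≤-Reasoning

∑-𝟙-false : ∀ {A : Set} xs (f : A → Bool) → (∀ x → f x ≡ false) → ∑[ x ∈ xs ] 𝟙 (f x) ≡ 0
∑-𝟙-false xs f f≡false = trans (∑-cong xs (λ x → cong 𝟙 (f≡false x))) (∑-zero xs)

∑∑-𝟙-∧ : ∀ {A B : Set} (xs : List A) (ys : List B) (f : A → Bool) (g : B → Bool) →
  ∑[ x ∈ xs ] ∑[ y ∈ ys ] 𝟙 (f x ∧ g y) ≡ ∑[ x ∈ xs ] 𝟙 (f x) * ∑[ y ∈ ys ] 𝟙 (g y)
∑∑-𝟙-∧ xs ys f g = begin
  ∑[ x ∈ xs ] ∑[ y ∈ ys ] 𝟙 (f x ∧ g y)      ≡⟨ ∑-cong xs (λ x → ∑-cong ys (λ y → 𝟙-∧ (f x) (g y))) ⟩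
  ∑[ x ∈ xs ] ∑[ y ∈ ys ] (𝟙 (f x) * 𝟙 (g y)) ≡⟨ ∑-cong xs (λ x → *-distribˡ-∑ (𝟙 (f x)) ys (λ y → 𝟙 (g y))) ⟨
  ∑[ x ∈ xs ] (𝟙 (f x) * G)                   ≡⟨ ∑-cong xs (λ x → *-comm (𝟙 (f x)) G) ⟩
  ∑[ x ∈ xs ] (G * 𝟙 (f x))                   ≡⟨ *-distribˡ-∑ G xs (λ x → 𝟙 (f x)) ⟨
  G * ∑[ x ∈ xs ] 𝟙 (f x)                     ≡⟨ *-comm G _ ⟩
  ∑[ x ∈ xs ] 𝟙 (f x) * G                     ∎
  where
  open ≡-Reasoning
  G = ∑[ y ∈ ys ] 𝟙 (g y)

length≡∑1 : ∀ {A : Set} (xs : List A) → length xs ≡ ∑[ x ∈ xs ] 1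
length≡∑1 []       = refl
length≡∑1 (x ∷ xs) = cong suc (length≡∑1 xs)

∑-filterᵇ : ∀ {A : Set} (p : A → Bool) xs (f : A → ℕ) → ∑[ y ∈ filterᵇ p xs ] f y ≡ ∑[ x ∈ xs ] (𝟙 (p x) * f x)
∑-filterᵇ p []       f = refl
∑-filterᵇ p (x ∷ xs) f with p x
... | true  = cong₂ _+_ (sym (+-identityʳ (f x))) (∑-filterᵇ p xs f)
... | false = ∑-filterᵇ p xs f

count-lookup : ∀ {A : Set} (ys : List A) (f : A → Bool) → count (λ i → f (List.lookup ys i)) ≡ ∑[ y ∈ ys ] 𝟙 (f y)
count-lookup []       f = refl
count-lookup (y ∷ ys) f = cong (𝟙 (f y) +_) (count-lookup ys f)

count-cong : ∀ {m} {f g : Fin m → Bool} → (∀ x → f x ≡ g x) → count f ≡ count g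
count-cong {zero}  f≗g = refl
count-cong {suc m} f≗g = cong₂ _+_ (cong 𝟙 (f≗g Fin.zero)) (count-cong (λ x → f≗g (Fin.suc x)))

allB-cong : ∀ {m} {f g : Fin m → Bool} → (∀ x → f x ≡ g x) → allB f ≡ allB g
allB-cong {zero}  f≗g = refl
allB-cong {suc m} f≗g = cong₂ _∧_ (f≗g Fin.zero) (allB-cong (λ x → f≗g (Fin.suc x)))

anyB-cong : ∀ {m} {f g : Fin m → Bool} → (∀ x → f x ≡ g x) → anyB f ≡ anyB g
anyB-cong {zero}  f≗g = refl
anyB-cong {suc m} f≗g = cong₂ _∨_ (f≗g Fin.zero) (anyB-cong (λ x → f≗g (Fin.suc x)))

∣tabulate∣≡count : ∀ {m} (f : Fin m → Bool) → ∣ tabulate f ∣ ≡ count f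
∣tabulate∣≡count {zero}  f = refl
∣tabulate∣≡count {suc m} f with f Fin.zero
... | true  = cong suc (∣tabulate∣≡count (λ x → f (Fin.suc x)))
... | false = ∣tabulate∣≡count (λ x → f (Fin.suc x))

anyB-false : ∀ {m} (f : Fin m → Bool) → (∀ x → f x ≡ false) → anyB f ≡ false
anyB-false {zero}  f f≡false = refl
anyB-false {suc m} f f≡false rewrite f≡false Fin.zero = anyB-false (λ x → f (Fin.suc x)) (λ x → f≡false (Fin.suc x))

-- Subsets of a finite set

≡ᵇ-true⇒≡ : ∀ {m n} → (m ≡ᵇ n) ≡ true → m ≡ n
≡ᵇ-true⇒≡ {m} {n} e = ≡ᵇ⇒≡ m n (Equivalence.from T-≡ e)

≡⇒≡ᵇ-true : ∀ {m n} → m ≡ n → (m ≡ᵇ n) ≡ true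
≡⇒≡ᵇ-true {m} {n} e = Equivalence.to T-≡ (≡⇒≡ᵇ m n e)

subsets : ∀ n → List (Subset n)
subsets zero    = [] ∷ []
subsets (suc n) = map (false ∷_) (subsets n) ++ map (true ∷_) (subsets n)

∑-subsets-suc : ∀ n (f : Subset (suc n) → ℕ) →
  ∑[ P ∈ subsets (suc n) ] f P ≡ ∑[ P ∈ subsets n ] f (false ∷ P) + ∑[ P ∈ subsets n ] f (true ∷ P)
∑-subsets-suc n f = trans (∑-++ (map (false ∷_) (subsets n)) _ f)
                          (cong₂ _+_ (∑-map (false ∷_) (subsets n) f) (∑-map (true ∷_) (subsets n) f))

module _ {n : ℕ} where

  _⊆ᵇ_ : Subset n → Subset n → Bool
  L ⊆ᵇ P = allB (λ x → not (lookup L x) ∨ lookup P x)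

  _meets_ : Subset n → Subset n → Bool
  M meets P = anyB (λ x → lookup M x ∧ lookup P x)

  sizedBetween : ℕ → Subset n → Subset n → Subset n → Bool
  sizedBetween s L M P = (∣ P ∣ ≡ᵇ s) ∧ (L ⊆ᵇ P ∧ not (M meets P))

p⊆ᵇq⇒∣p∣≤∣q∣ : ∀ {n} (p q : Subset n) → p ⊆ᵇ q ≡ true → ∣ p ∣ ≤ ∣ q ∣
p⊆ᵇq⇒∣p∣≤∣q∣ []          []          _   = z≤n
p⊆ᵇq⇒∣p∣≤∣q∣ (false ∷ p) (false ∷ q) p⊆q = p⊆ᵇq⇒∣p∣≤∣q∣ p q p⊆q
p⊆ᵇq⇒∣p∣≤∣q∣ (false ∷ p) (true  ∷ q) p⊆q = m≤n⇒m≤1+n (p⊆ᵇq⇒∣p∣≤∣q∣ p q p⊆q)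
p⊆ᵇq⇒∣p∣≤∣q∣ (true  ∷ p) (true  ∷ q) p⊆q = s≤s (p⊆ᵇq⇒∣p∣≤∣q∣ p q p⊆q)

-- P is determined by its j points outside L, which are chosen among the points outside L ∪ M.
∑-sizedBetween : ∀ {n} (L M : Subset n) → L ∩ M ≡ ⊥ → ∀ j →
  ∑[ P ∈ subsets n ] 𝟙 (sizedBetween (∣ L ∣ + j) L M P) ≡ ∣ ∁ (L ∪ M) ∣ C j
∑-sizedBetween []      []      _ zero    = refl
∑-sizedBetween []      []      _ (suc j) = refl
∑-sizedBetween (l ∷ L) (m ∷ M) L∩M≡⊥ j with ∷-injective L∩M≡⊥
∑-sizedBetween (true  ∷ L) (true  ∷ M) _ j | () , _
∑-sizedBetween {suc n} (true ∷ L) (false ∷ M) _ j | _ , L∩M≡⊥ =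
  trans (∑-subsets-suc n _)
        (cong₂ _+_ (∑-𝟙-false (subsets n) _ (λ P → ∧-zeroʳ _)) (∑-sizedBetween L M L∩M≡⊥ j))
∑-sizedBetween {suc n} (false ∷ L) (true ∷ M) _ j | _ , L∩M≡⊥ =
  trans (∑-subsets-suc n _)
        (trans (cong₂ _+_ (∑-sizedBetween L M L∩M≡⊥ j)
                          (∑-𝟙-false (subsets n) _ (λ P → trans (cong ((suc ∣ P ∣ ≡ᵇ ∣ L ∣ + j) ∧_) (∧-zeroʳ (L ⊆ᵇ P))) (∧-zeroʳ _))))
               (+-identityʳ _))
∑-sizedBetween {suc n} (false ∷ L) (false ∷ M) _ zero | _ , L∩M≡⊥ =
  trans (∑-subsets-suc n _)
        (cong₂ _+_ (∑-sizedBetween L M L∩M≡⊥ 0) (∑-𝟙-false (subsets n) _ too-large))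
  where
  too-large : ∀ P → sizedBetween (∣ L ∣ + 0) (false ∷ L) (false ∷ M) (true ∷ P) ≡ false
  too-large P with L ⊆ᵇ P in L⊆P | suc ∣ P ∣ ≡ᵇ ∣ L ∣ + 0 in ∣P∣<∣L∣
  ... | false | _     = ∧-zeroʳ _
  ... | true  | false = refl
  ... | true  | true  = ⊥-elim (<⇒≱ (subst (∣ P ∣ <_) (+-identityʳ ∣ L ∣) (≤-reflexive (≡ᵇ-true⇒≡ ∣P∣<∣L∣)))
                                    (p⊆ᵇq⇒∣p∣≤∣q∣ L P L⊆P))
∑-sizedBetween {suc n} (false ∷ L) (false ∷ M) _ (suc j) | _ , L∩M≡⊥ =
  trans (∑-subsets-suc n _)
        (trans (cong₂ _+_ (∑-sizedBetween L M L∩M≡⊥ (suc j))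
                          (trans (cong (λ s → ∑[ P ∈ subsets n ] 𝟙 (sizedBetween s (false ∷ L) (false ∷ M) (true ∷ P)))
                                       (+-suc ∣ L ∣ j))
                                 (∑-sizedBetween L M L∩M≡⊥ j)))
               (trans (+-comm (∣ ∁ (L ∪ M) ∣ C suc j) _) (nCk+nC[k+1]≡[n+1]C[k+1] _ j)))

⊥⊆ᵇ : ∀ {n} (P : Subset n) → ⊥ ⊆ᵇ P ≡ true
⊥⊆ᵇ []      = refl
⊥⊆ᵇ (_ ∷ P) = ⊥⊆ᵇ P

⊥-meets≡false : ∀ {n} (P : Subset n) → ⊥ meets P ≡ false
⊥-meets≡false []      = refl
⊥-meets≡false (_ ∷ P) = ⊥-meets≡false P

∑-k-sets-avoiding : ∀ {n} (M : Subset n) k →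
  ∑[ P ∈ subsets n ] 𝟙 ((∣ P ∣ ≡ᵇ k) ∧ not (M meets P)) ≡ ∣ ∁ M ∣ C k
∑-k-sets-avoiding {n} M k = begin
  ∑[ P ∈ subsets n ] 𝟙 ((∣ P ∣ ≡ᵇ k) ∧ not (M meets P))
    ≡⟨ ∑-cong (subsets n) (λ P → cong₂ (λ s b → 𝟙 ((∣ P ∣ ≡ᵇ s) ∧ (b ∧ not (M meets P))))
                                       (sym (cong (_+ k) (∣⊥∣≡0 n))) (sym (⊥⊆ᵇ P))) ⟩
  ∑[ P ∈ subsets n ] 𝟙 (sizedBetween (∣ ⊥ {n} ∣ + k) ⊥ M P)
    ≡⟨ ∑-sizedBetween ⊥ M (∩-zeroˡ M) k ⟩
  ∣ ∁ (⊥ ∪ M) ∣ C k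
    ≡⟨ cong (λ X → ∣ ∁ X ∣ C k) (∪-identityˡ M) ⟩
  ∣ ∁ M ∣ C k ∎
  where open ≡-Reasoning

∑-k-sets : ∀ n k → ∑[ P ∈ subsets n ] 𝟙 (∣ P ∣ ≡ᵇ k) ≡ n C k
∑-k-sets n k = begin
  ∑[ P ∈ subsets n ] 𝟙 (∣ P ∣ ≡ᵇ k)
    ≡⟨ ∑-cong (subsets n) (λ P → cong 𝟙 (trans (sym (∧-identityʳ _))
                                       (cong (λ b → (∣ P ∣ ≡ᵇ k) ∧ not b) (sym (⊥-meets≡false P))))) ⟩
  ∑[ P ∈ subsets n ] 𝟙 ((∣ P ∣ ≡ᵇ k) ∧ not (⊥ meets P))
    ≡⟨ ∑-k-sets-avoiding (⊥ {n}) k ⟩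
  ∣ ∁ (⊥ {n}) ∣ C k
    ≡⟨ cong (_C k) (trans (∣∁p∣≡n∸∣p∣ (⊥ {n})) (cong (n ∸_) (∣⊥∣≡0 n))) ⟩
  n C k ∎
  where open ≡-Reasoning

∈-subsets : ∀ {n} (A : Subset n) → A ∈ subsets n
∈-subsets []          = here refl
∈-subsets (false ∷ A) = ∈-++⁺ˡ (∈-map⁺ (false ∷_) (∈-subsets A))
∈-subsets (true  ∷ A) = ∈-++⁺ʳ (map (false ∷_) (subsets _)) (∈-map⁺ (true ∷_) (∈-subsets A))

⋃ˢ : ∀ {n} → (Subset n → Bool) → Subset n
⋃ˢ {n} R = tabulate (λ x → any (λ A → R A ∧ lookup A x) (subsets n))

∈-⋃ˢ⁺ : ∀ {n} (R : Subset n → Bool) {A x} → R A ≡ true → lookup A x ≡ true → lookup (⋃ˢ R) x ≡ true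
∈-⋃ˢ⁺ {n} R {A} {x} RA Ax = trans (lookup∘tabulate _ x)
  (Equivalence.to T-≡ (any⁺ _ (lose (∈-subsets A) (Equivalence.from T-≡ (cong₂ _∧_ RA Ax)))))

∈-⋃ˢ⁻ : ∀ {n} (R : Subset n → Bool) {x} → lookup (⋃ˢ R) x ≡ true → ∃ λ A → R A ≡ true × lookup A x ≡ true
∈-⋃ˢ⁻ {n} R {x} Ux with satisfied (any⁻ _ (subsets n) (Equivalence.from T-≡ (trans (sym (lookup∘tabulate _ x)) Ux)))
... | A , RA∧Ax = A , ∧-conicalˡ _ _ RA∧Ax′ , ∧-conicalʳ _ _ RA∧Ax′
  where RA∧Ax′ = Equivalence.to T-≡ RA∧Ax

∣∁∁p∣≡∣p∣ : ∀ {n} (p : Subset n) → ∣ ∁ (∁ p) ∣ ≡ ∣ p ∣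
∣∁∁p∣≡∣p∣ p = cong ∣_∣ (trans (sym (map-∘ not not p)) (trans (map-cong not-involutive p) (map-id p)))

∑-𝟙-≤-⋃ˢ : ∀ {n k} (R : Subset n → Bool) → (∀ A → R A ≡ true → ∣ A ∣ ≡ k) →
  ∑[ A ∈ subsets n ] 𝟙 (R A) ≤ ∣ ⋃ˢ R ∣ C k
∑-𝟙-≤-⋃ˢ {n} {k} R ∣R∣≡k = begin
  ∑[ A ∈ subsets n ] 𝟙 (R A)                                    ≤⟨ ∑-mono-≤ (subsets n) R⇒avoids-∁U ⟩
  ∑[ A ∈ subsets n ] 𝟙 ((∣ A ∣ ≡ᵇ k) ∧ not (∁ (⋃ˢ R) meets A))  ≡⟨ ∑-k-sets-avoiding (∁ (⋃ˢ R)) k ⟩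
  ∣ ∁ (∁ (⋃ˢ R)) ∣ C k                                          ≡⟨ cong (_C k) (∣∁∁p∣≡∣p∣ (⋃ˢ R)) ⟩
  ∣ ⋃ˢ R ∣ C k                                                  ∎
  where
  open ≤-Reasoning
  R⇒avoids-∁U : ∀ A → 𝟙 (R A) ≤ 𝟙 ((∣ A ∣ ≡ᵇ k) ∧ not (∁ (⋃ˢ R) meets A))
  R⇒avoids-∁U A with R A in RA
  ... | false = z≤n
  ... | true  = ≤-reflexive (cong 𝟙 (sym (cong₂ _∧_ (≡⇒≡ᵇ-true (∣R∣≡k A RA)) (cong not (anyB-false _ outside-U)))))
    where
    outside-U : ∀ x → lookup (∁ (⋃ˢ R)) x ∧ lookup A x ≡ false
    outside-U x rewrite lookup-map x not (⋃ˢ R) with lookup A x in Ax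
    ... | false = ∧-zeroʳ _
    ... | true  rewrite ∈-⋃ˢ⁺ R RA Ax = refl

∩≡⊥⇒¬both : ∀ {n} {p q : Subset n} x → p ∩ q ≡ ⊥ → lookup p x ≡ true → lookup q x ≡ true → Empty
∩≡⊥⇒¬both {p = p} {q} x p∩q≡⊥ px qx with true≡false
  where
  open ≡-Reasoning
  true≡false : true ≡ false
  true≡false = begin
    true                    ≡⟨ cong₂ _∧_ px qx ⟨
    lookup p x ∧ lookup q x ≡⟨ lookup-zipWith _∧_ x p q ⟨
    lookup (p ∩ q) x        ≡⟨ cong (λ r → lookup r x) p∩q≡⊥ ⟩
    lookup ⊥ x              ≡⟨ lookup-replicate x false ⟩
    false                   ∎
... | ()

¬both⇒∩≡⊥ : ∀ {n} (p q : Subset n) → (∀ x → lookup p x ≡ true → lookup q x ≡ true → Empty) → p ∩ q ≡ ⊥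
¬both⇒∩≡⊥ []          []          _    = refl
¬both⇒∩≡⊥ (true ∷ p)  (true ∷ q)  ¬both = ⊥-elim (¬both Fin.zero refl refl)
¬both⇒∩≡⊥ (true ∷ p)  (false ∷ q) ¬both = cong (false ∷_) (¬both⇒∩≡⊥ p q (λ x → ¬both (Fin.suc x)))
¬both⇒∩≡⊥ (false ∷ p) (_ ∷ q)     ¬both = cong (false ∷_) (¬both⇒∩≡⊥ p q (λ x → ¬both (Fin.suc x)))

∣p∪q∣≡∣p∣+∣q∣ : ∀ {n} (p q : Subset n) → p ∩ q ≡ ⊥ → ∣ p ∪ q ∣ ≡ ∣ p ∣ + ∣ q ∣
∣p∪q∣≡∣p∣+∣q∣ []      []      _     = refl
∣p∪q∣≡∣p∣+∣q∣ (a ∷ p) (b ∷ q) p∩q≡⊥ with ∷-injective p∩q≡⊥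
∣p∪q∣≡∣p∣+∣q∣ (true  ∷ p) (true  ∷ q) _ | () , _
∣p∪q∣≡∣p∣+∣q∣ (true  ∷ p) (false ∷ q) _ | _ , p∩q≡⊥ = cong suc (∣p∪q∣≡∣p∣+∣q∣ p q p∩q≡⊥)
∣p∪q∣≡∣p∣+∣q∣ (false ∷ p) (true  ∷ q) _ | _ , p∩q≡⊥ = trans (cong suc (∣p∪q∣≡∣p∣+∣q∣ p q p∩q≡⊥)) (sym (+-suc ∣ p ∣ ∣ q ∣))
∣p∪q∣≡∣p∣+∣q∣ (false ∷ p) (false ∷ q) _ | _ , p∩q≡⊥ = ∣p∪q∣≡∣p∣+∣q∣ p q p∩q≡⊥

meets≡false⇒∩≡⊥ : ∀ {n} (A B : Subset n) → A meets B ≡ false → A ∩ B ≡ ⊥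
meets≡false⇒∩≡⊥ []          []          _ = refl
meets≡false⇒∩≡⊥ (true  ∷ A) (true  ∷ B) ()
meets≡false⇒∩≡⊥ (true  ∷ A) (false ∷ B) e = cong (false ∷_) (meets≡false⇒∩≡⊥ A B e)
meets≡false⇒∩≡⊥ (false ∷ A) (_     ∷ B) e = cong (false ∷_) (meets≡false⇒∩≡⊥ A B e)

⊆ᵇ-¬meets⇒∩≡⊥ : ∀ {n} (A B P : Subset n) → A ⊆ᵇ P ≡ true → B meets P ≡ false → A ∩ B ≡ ⊥
⊆ᵇ-¬meets⇒∩≡⊥ []          []          []          _ _ = refl
⊆ᵇ-¬meets⇒∩≡⊥ (true  ∷ A) (_     ∷ B) (false ∷ P) () _
⊆ᵇ-¬meets⇒∩≡⊥ (true  ∷ A) (true  ∷ B) (true  ∷ P) _ ()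
⊆ᵇ-¬meets⇒∩≡⊥ (true  ∷ A) (false ∷ B) (true  ∷ P) A⊆P ¬BP = cong (false ∷_) (⊆ᵇ-¬meets⇒∩≡⊥ A B P A⊆P ¬BP)
⊆ᵇ-¬meets⇒∩≡⊥ (false ∷ A) (true  ∷ B) (true  ∷ P) _ ()
⊆ᵇ-¬meets⇒∩≡⊥ (false ∷ A) (true  ∷ B) (false ∷ P) A⊆P ¬BP = cong (false ∷_) (⊆ᵇ-¬meets⇒∩≡⊥ A B P A⊆P ¬BP)
⊆ᵇ-¬meets⇒∩≡⊥ (false ∷ A) (false ∷ B) (_     ∷ P) A⊆P ¬BP = cong (false ∷_) (⊆ᵇ-¬meets⇒∩≡⊥ A B P A⊆P ¬BP)

∃-k-subset : ∀ {n k} (P : Subset n) → k ≤ ∣ P ∣ → ∃ λ A → ∣ A ∣ ≡ k × A ⊆ᵇ P ≡ true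
∃-k-subset {n} {zero} P           _ = ⊥ , ∣⊥∣≡0 n , ⊥⊆ᵇ P
∃-k-subset {k = suc k} (true ∷ P)  (s≤s k≤∣P∣) with ∃-k-subset P k≤∣P∣
... | A , ∣A∣≡k , A⊆P = true ∷ A , cong suc ∣A∣≡k , A⊆P
∃-k-subset {k = suc k} (false ∷ P) k<∣P∣ with ∃-k-subset P k<∣P∣
... | A , ∣A∣≡k , A⊆P = false ∷ A , ∣A∣≡k , A⊆P

⊆ᵇ∁⇒meets≡false : ∀ {n} (A P : Subset n) → A ⊆ᵇ ∁ P ≡ true → A meets P ≡ false
⊆ᵇ∁⇒meets≡false []          []          _   = refl
⊆ᵇ∁⇒meets≡false (true  ∷ A) (true  ∷ P) ()
⊆ᵇ∁⇒meets≡false (true  ∷ A) (false ∷ P) A⊆∁P = ⊆ᵇ∁⇒meets≡false A P A⊆∁P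
⊆ᵇ∁⇒meets≡false (false ∷ A) (_     ∷ P) A⊆∁P = ⊆ᵇ∁⇒meets≡false A P A⊆∁P

-- The lower bound

isEdgeᵇ : ∀ {n} → ℕ → Subset n → Subset n → Bool
isEdgeᵇ k A B = (∣ A ∣ ≡ᵇ k) ∧ ((∣ B ∣ ≡ᵇ k) ∧ not (A meets B))

∑∑-isEdgeᵇ : ∀ n k → ∑[ A ∈ subsets n ] ∑[ B ∈ subsets n ] 𝟙 (isEdgeᵇ k A B) ≡ ((n ∸ k) C k) * (n C k)
∑∑-isEdgeᵇ n k = begin
  ∑[ A ∈ subsets n ] ∑[ B ∈ subsets n ] 𝟙 (isEdgeᵇ k A B) ≡⟨ ∑-cong (subsets n) neighbours ⟩
  ∑[ A ∈ subsets n ] (((n ∸ k) C k) * 𝟙 (∣ A ∣ ≡ᵇ k))   ≡⟨ *-distribˡ-∑ ((n ∸ k) C k) (subsets n) _ ⟨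
  ((n ∸ k) C k) * ∑[ A ∈ subsets n ] 𝟙 (∣ A ∣ ≡ᵇ k)     ≡⟨ cong (((n ∸ k) C k) *_) (∑-k-sets n k) ⟩
  ((n ∸ k) C k) * (n C k)                               ∎
  where
  open ≡-Reasoning
  neighbours : ∀ A → ∑[ B ∈ subsets n ] 𝟙 (isEdgeᵇ k A B) ≡ ((n ∸ k) C k) * 𝟙 (∣ A ∣ ≡ᵇ k)
  neighbours A with ∣ A ∣ ≡ᵇ k in ∣A∣≡ᵇk
  ... | false = trans (∑-zero (subsets n)) (sym (*-zeroʳ ((n ∸ k) C k)))
  ... | true  = begin
    ∑[ B ∈ subsets n ] 𝟙 ((∣ B ∣ ≡ᵇ k) ∧ not (A meets B)) ≡⟨ ∑-k-sets-avoiding A k ⟩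
    ∣ ∁ A ∣ C k                                            ≡⟨ cong (_C k) (∣∁p∣≡n∸∣p∣ A) ⟩
    (n ∸ ∣ A ∣) C k                                        ≡⟨ cong (λ s → (n ∸ s) C k) (≡ᵇ-true⇒≡ {∣ A ∣} {k} ∣A∣≡ᵇk) ⟩
    (n ∸ k) C k                                            ≡⟨ *-identityʳ _ ⟨
    ((n ∸ k) C k) * 1                                      ∎

-- m possibly empty bicliques of I_n(k,k), given by predicates on all subsets of the n-set,
-- covering every edge at least d times.
record DisjointPairCover (n k d m : ℕ) : Set where
  field
    left right  : Fin m → Subset n → Bool
    left-size   : ∀ i A → left i A ≡ true → ∣ A ∣ ≡ k
    right-size  : ∀ i B → right i B ≡ true → ∣ B ∣ ≡ k
    left∩right  : ∀ i A B → left i A ≡ true → right i B ≡ true → A ∩ B ≡ ⊥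
    covers      : ∀ A B → ∣ A ∣ ≡ k → ∣ B ∣ ≡ k → A ∩ B ≡ ⊥ → d ≤ count (λ i → left i A ∧ right i B)

-- The two sides of a biclique lie in the disjoint sets ⋃ˢ S and ⋃ˢ T.
∑∑-biclique-≤ : ∀ {t k} (S T : Subset (t + t) → Bool) →
  (∀ A → S A ≡ true → ∣ A ∣ ≡ k) → (∀ B → T B ≡ true → ∣ B ∣ ≡ k) →
  (∀ A B → S A ≡ true → T B ≡ true → A ∩ B ≡ ⊥) →
  ∑[ A ∈ subsets (t + t) ] ∑[ B ∈ subsets (t + t) ] 𝟙 (S A ∧ T B) ≤ (t C k) * (t C k)
∑∑-biclique-≤ {t} {k} S T ∣S∣≡k ∣T∣≡k S∩T≡⊥ = begin
  ∑[ A ∈ subsets (t + t) ] ∑[ B ∈ subsets (t + t) ] 𝟙 (S A ∧ T B) ≡⟨ ∑∑-𝟙-∧ (subsets (t + t)) (subsets (t + t)) S T ⟩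
  ∑[ A ∈ subsets (t + t) ] 𝟙 (S A) * ∑[ B ∈ subsets (t + t) ] 𝟙 (T B)
    ≤⟨ *-mono-≤ (∑-𝟙-≤-⋃ˢ S ∣S∣≡k) (∑-𝟙-≤-⋃ˢ T ∣T∣≡k) ⟩
  (∣ ⋃ˢ S ∣ C k) * (∣ ⋃ˢ T ∣ C k)                                   ≤⟨ C-product-≤ k ∣U∣+∣W∣≤t+t ⟩
  (t C k) * (t C k)                                                ∎
  where
  open ≤-Reasoning
  U∩W≡⊥ : ⋃ˢ S ∩ ⋃ˢ T ≡ ⊥
  U∩W≡⊥ = ¬both⇒∩≡⊥ (⋃ˢ S) (⋃ˢ T) λ x Ux Wx →
    let (A , SA , Ax) = ∈-⋃ˢ⁻ S Ux ; (B , TB , Bx) = ∈-⋃ˢ⁻ T Wx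
    in ∩≡⊥⇒¬both x (S∩T≡⊥ A B SA TB) Ax Bx
  ∣U∣+∣W∣≤t+t : ∣ ⋃ˢ S ∣ + ∣ ⋃ˢ T ∣ ≤ t + t
  ∣U∣+∣W∣≤t+t = subst (_≤ t + t) (∣p∪q∣≡∣p∣+∣q∣ (⋃ˢ S) (⋃ˢ T) U∩W≡⊥) (∣p∣≤n (⋃ˢ S ∪ ⋃ˢ T))

module _ {t k d m : ℕ} (𝒞 : DisjointPairCover (t + t) k d m) where
  open DisjointPairCover 𝒞

  DisjointPairCover-bound : d * (((t + t ∸ k) C k) * ((t + t) C k)) ≤ m * ((t C k) * (t C k))
  DisjointPairCover-bound = begin
    d * (((t + t ∸ k) C k) * ((t + t) C k))               ≡⟨ cong (d *_) (∑∑-isEdgeᵇ (t + t) k) ⟨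
    d * ∑[ A ∈ X ] ∑[ B ∈ X ] 𝟙 (isEdgeᵇ k A B)           ≡⟨ *-distribˡ-∑ d X _ ⟩
    ∑[ A ∈ X ] (d * ∑[ B ∈ X ] 𝟙 (isEdgeᵇ k A B))         ≡⟨ ∑-cong X (λ A → *-distribˡ-∑ d X _) ⟩
    ∑[ A ∈ X ] ∑[ B ∈ X ] (d * 𝟙 (isEdgeᵇ k A B))         ≤⟨ ∑-mono-≤ X (λ A → ∑-mono-≤ X (covered A)) ⟩
    ∑[ A ∈ X ] ∑[ B ∈ X ] count (λ i → left i A ∧ right i B)
      ≤⟨ ∑∑-count-≤ X X (λ i A B → left i A ∧ right i B)
           (λ i → ∑∑-biclique-≤ (left i) (right i) (left-size i) (right-size i) (left∩right i)) ⟩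
    m * ((t C k) * (t C k))                               ∎
    where
    open ≤-Reasoning
    X = subsets (t + t)
    covered : ∀ A B → d * 𝟙 (isEdgeᵇ k A B) ≤ count (λ i → left i A ∧ right i B)
    covered A B with isEdgeᵇ k A B in edge
    ... | false = ≤-trans (≤-reflexive (*-zeroʳ d)) z≤n
    ... | true  = ≤-trans (≤-reflexive (*-identityʳ d)) (covers A B ∣A∣≡k ∣B∣≡k A∩B≡⊥)
      where
      B-edge : (∣ B ∣ ≡ᵇ k) ∧ not (A meets B) ≡ true
      B-edge = ∧-conicalʳ (∣ A ∣ ≡ᵇ k) _ edge
      ∣A∣≡k : ∣ A ∣ ≡ k
      ∣A∣≡k = ≡ᵇ-true⇒≡ (∧-conicalˡ (∣ A ∣ ≡ᵇ k) _ edge)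
      ∣B∣≡k : ∣ B ∣ ≡ k
      ∣B∣≡k = ≡ᵇ-true⇒≡ (∧-conicalˡ (∣ B ∣ ≡ᵇ k) _ B-edge)
      A∩B≡⊥ : A ∩ B ≡ ⊥
      A∩B≡⊥ = meets≡false⇒∩≡⊥ A B (not-injective (∧-conicalʳ (∣ B ∣ ≡ᵇ k) _ B-edge))

DisjointPairCover⇒[2t]Ct≤m : ∀ {k j m} → let t = k + j in
  DisjointPairCover (t + t) k ((j + j) C j) m → (t + t) C t ≤ m
DisjointPairCover⇒[2t]Ct≤m {k} {j} {m} 𝒞 = *-cancelʳ-≤ ((t + t) C t) m c {{c≢0}} (begin
  ((t + t) C t) * c                                 ≡⟨ C-identity k j ⟨
  ((j + j) C j) * (((t + t) C k) * ((k + (j + j)) C k)) ≡⟨ cong (((j + j) C j) *_) (*-comm ((t + t) C k) _) ⟩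
  ((j + j) C j) * (((k + (j + j)) C k) * ((t + t) C k)) ≡⟨ cong (λ s → ((j + j) C j) * ((s C k) * ((t + t) C k))) 2t∸k≡k+2j ⟨
  ((j + j) C j) * (((t + t ∸ k) C k) * ((t + t) C k))   ≤⟨ DisjointPairCover-bound 𝒞 ⟩
  m * c                                             ∎)
  where
  open ≤-Reasoning
  t = k + j
  c = (t C k) * (t C k)
  c≢0 : NonZero c
  c≢0 = >-nonZero (*-mono-< (0<nCk (m≤m+n k j)) (0<nCk (m≤m+n k j)))
  2t∸k≡k+2j : t + t ∸ k ≡ k + (j + j)
  2t∸k≡k+2j = trans (cong (_∸ k) (regroup k j)) (m+n∸m≡n k (k + (j + j)))
    where
    regroup : ∀ k j → (k + j) + (k + j) ≡ k + (k + (j + j))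
    regroup = solve-∀

blocksContaining : ∀ {n m} → (Fin n → Subset m) → Fin m → Subset n
blocksContaining ℬ x = tabulate (λ l → lookup (ℬ l) x)

∣⋂∖⋃∣≡count : ∀ {n m} (ℬ : Fin n → Subset m) (L M : Subset n) →
  ∣ (⋂[ ℬ ] L) ∖ (⋃[ ℬ ] M) ∣ ≡ count (λ x → L ⊆ᵇ blocksContaining ℬ x ∧ not (M meets blocksContaining ℬ x))
∣⋂∖⋃∣≡count ℬ L M =
  trans (∣tabulate∣≡count (λ x → lookup (⋂[ ℬ ] L) x ∧ not (lookup (⋃[ ℬ ] M) x))) (count-cong pointwise)
  where
  pointwise : ∀ x → lookup (⋂[ ℬ ] L) x ∧ not (lookup (⋃[ ℬ ] M) x)
                  ≡ L ⊆ᵇ blocksContaining ℬ x ∧ not (M meets blocksContaining ℬ x)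
  pointwise x rewrite lookup∘tabulate (λ x → allB (λ l → not (lookup L l) ∨ lookup (ℬ l) x)) x
                    | lookup∘tabulate (λ x → anyB (λ l → lookup M l ∧ lookup (ℬ l) x)) x =
    cong₂ (λ a b → a ∧ not b)
      (allB-cong (λ l → cong (not (lookup L l) ∨_) (sym (lookup∘tabulate (λ l → lookup (ℬ l) x) l))))
      (anyB-cong (λ l → cong (lookup M l ∧_) (sym (lookup∘tabulate (λ l → lookup (ℬ l) x) l))))

module _ {n k : ℕ} (f : k -subsets-of n → Bool) where

  extendᵇ : Subset n → Bool
  extendᵇ A with ∣ A ∣ ≟ k
  ... | yes ∣A∣≡k = f (A , ∣A∣≡k)
  ... | no  _     = false

  extendᵇ-true : ∀ A → extendᵇ A ≡ true → Σ (∣ A ∣ ≡ k) λ ∣A∣≡k → f (A , ∣A∣≡k) ≡ true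
  extendᵇ-true A fA with ∣ A ∣ ≟ k
  ... | yes ∣A∣≡k = ∣A∣≡k , fA

  extendᵇ-eq : ∀ A (∣A∣≡k : ∣ A ∣ ≡ k) → extendᵇ A ≡ f (A , ∣A∣≡k)
  extendᵇ-eq A ∣A∣≡k with ∣ A ∣ ≟ k
  ... | yes ∣A∣≡k′ = cong (λ e → f (A , e)) (≡-irrelevant ∣A∣≡k′ ∣A∣≡k)
  ... | no  ∣A∣≢k  = contradiction ∣A∣≡k ∣A∣≢k

bicliqueCover⇒DisjointPairCover : ∀ {n k d m} → IsDBicliqueCover d (I n k k) m → DisjointPairCover n k d m
bicliqueCover⇒DisjointPairCover {n} {k} {d} (ℬ , covered) = record
  { left       = λ i → extendᵇ (S (ℬ i))
  ; right      = λ i → extendᵇ (T (ℬ i))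
  ; left-size  = λ i A SA → proj₁ (extendᵇ-true (S (ℬ i)) A SA)
  ; right-size = λ i B TB → proj₁ (extendᵇ-true (T (ℬ i)) B TB)
  ; left∩right = λ i A B SA TB →
      let (∣A∣≡k , SA′) = extendᵇ-true (S (ℬ i)) A SA ; (∣B∣≡k , TB′) = extendᵇ-true (T (ℬ i)) B TB
      in complete (ℬ i) (A , ∣A∣≡k) (B , ∣B∣≡k) SA′ TB′
  ; covers     = λ A B ∣A∣≡k ∣B∣≡k A∩B≡⊥ →
      subst (d ≤_) (count-cong (λ i → sym (cong₂ _∧_ (extendᵇ-eq (S (ℬ i)) A ∣A∣≡k) (extendᵇ-eq (T (ℬ i)) B ∣B∣≡k))))
            (covered (A , ∣A∣≡k) (B , ∣B∣≡k) A∩B≡⊥)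
  }

CFF⇒DisjointPairCover : ∀ {n k d m} → CFFExists k k d m n → DisjointPairCover n k d m
CFF⇒DisjointPairCover {n} {k} {d} (ℬ , isCFF) = record
  { left       = λ x A → (∣ A ∣ ≡ᵇ k) ∧ (A ⊆ᵇ blocksContaining ℬ x)
  ; right      = λ x B → (∣ B ∣ ≡ᵇ k) ∧ not (B meets blocksContaining ℬ x)
  ; left-size  = λ x A e → ≡ᵇ-true⇒≡ (∧-conicalˡ (∣ A ∣ ≡ᵇ k) _ e)
  ; right-size = λ x B e → ≡ᵇ-true⇒≡ (∧-conicalˡ (∣ B ∣ ≡ᵇ k) _ e)
  ; left∩right = λ x A B eA eB → ⊆ᵇ-¬meets⇒∩≡⊥ A B (blocksContaining ℬ x)
                   (∧-conicalʳ (∣ A ∣ ≡ᵇ k) _ eA) (not-injective (∧-conicalʳ (∣ B ∣ ≡ᵇ k) _ eB))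
  ; covers     = covers
  }
  where
  covers : ∀ A B → ∣ A ∣ ≡ k → ∣ B ∣ ≡ k → A ∩ B ≡ ⊥ →
    d ≤ count (λ x → ((∣ A ∣ ≡ᵇ k) ∧ (A ⊆ᵇ blocksContaining ℬ x)) ∧ ((∣ B ∣ ≡ᵇ k) ∧ not (B meets blocksContaining ℬ x)))
  covers A B ∣A∣≡k ∣B∣≡k A∩B≡⊥ rewrite ≡⇒≡ᵇ-true ∣A∣≡k | ≡⇒≡ᵇ-true ∣B∣≡k =
    subst (d ≤_) (∣⋂∖⋃∣≡count ℬ A B) (isCFF A B A∩B≡⊥ ∣A∣≡k ∣B∣≡k)

-- The construction

module HalfSets (k j : ℕ) where

  t = k + j
  d = (j + j) C j

  halves : List (Subset (t + t))
  halves = filterᵇ (λ P → ∣ P ∣ ≡ᵇ t) (subsets (t + t))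

  half : Fin (length halves) → Subset (t + t)
  half = List.lookup halves

  ∣half∣≡t : ∀ i → ∣ half i ∣ ≡ t
  ∣half∣≡t i = ≡ᵇ⇒≡ _ t (All.lookup (all-filter _ (subsets (t + t))) (∈-lookup i))

  length-halves : length halves ≡ (t + t) C t
  length-halves = begin
    length halves                                          ≡⟨ length≡∑1 halves ⟩
    ∑[ P ∈ halves ] 1                                      ≡⟨ ∑-filterᵇ _ (subsets (t + t)) (λ _ → 1) ⟩
    ∑[ P ∈ subsets (t + t) ] (𝟙 (∣ P ∣ ≡ᵇ t) * 1)         ≡⟨ ∑-cong (subsets (t + t)) (λ P → *-identityʳ _) ⟩
    ∑[ P ∈ subsets (t + t) ] 𝟙 (∣ P ∣ ≡ᵇ t)               ≡⟨ ∑-k-sets (t + t) t ⟩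
    (t + t) C t                                            ∎
    where open ≡-Reasoning

  count-halves-between : ∀ A B → ∣ A ∣ ≡ k → ∣ B ∣ ≡ k → A ∩ B ≡ ⊥ →
    count (λ i → A ⊆ᵇ half i ∧ not (B meets half i)) ≡ d
  count-halves-between A B ∣A∣≡k ∣B∣≡k A∩B≡⊥ = begin
    count (λ i → A ⊆ᵇ half i ∧ not (B meets half i))
      ≡⟨ count-lookup halves _ ⟩
    ∑[ P ∈ halves ] 𝟙 (A ⊆ᵇ P ∧ not (B meets P))
      ≡⟨ ∑-filterᵇ _ (subsets (t + t)) _ ⟩
    ∑[ P ∈ subsets (t + t) ] (𝟙 (∣ P ∣ ≡ᵇ t) * 𝟙 (A ⊆ᵇ P ∧ not (B meets P)))
      ≡⟨ ∑-cong (subsets (t + t)) (λ P → sym (trans (cong (λ s → 𝟙 (sizedBetween (s + j) A B P)) ∣A∣≡k)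
                                                     (𝟙-∧ (∣ P ∣ ≡ᵇ t) _))) ⟩
    ∑[ P ∈ subsets (t + t) ] 𝟙 (sizedBetween (∣ A ∣ + j) A B P)
      ≡⟨ ∑-sizedBetween A B A∩B≡⊥ j ⟩
    ∣ ∁ (A ∪ B) ∣ C j
      ≡⟨ cong (_C j) ∣∁[A∪B]∣≡j+j ⟩
    d ∎
    where
    open ≡-Reasoning
    ∣∁[A∪B]∣≡j+j : ∣ ∁ (A ∪ B) ∣ ≡ j + j
    ∣∁[A∪B]∣≡j+j = begin
      ∣ ∁ (A ∪ B) ∣             ≡⟨ ∣∁p∣≡n∸∣p∣ (A ∪ B) ⟩
      t + t ∸ ∣ A ∪ B ∣         ≡⟨ cong (t + t ∸_) (trans (∣p∪q∣≡∣p∣+∣q∣ A B A∩B≡⊥) (cong₂ _+_ ∣A∣≡k ∣B∣≡k)) ⟩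
      t + t ∸ (k + k)           ≡⟨ cong (_∸ (k + k)) (regroup k j) ⟩
      (j + j) + (k + k) ∸ (k + k) ≡⟨ m+n∸n≡m (j + j) (k + k) ⟩
      j + j                     ∎
      where
      regroup : ∀ k j → (k + j) + (k + j) ≡ (j + j) + (k + k)
      regroup = solve-∀

  halfBiclique : k ≤ t → Fin (length halves) → Biclique (I (t + t) k k)
  halfBiclique k≤t i = record
    { S          = λ (A , _) → A ⊆ᵇ half i
    ; T          = λ (B , _) → not (B meets half i)
    ; S-nonempty = let (A , ∣A∣≡k , A⊆P) = ∃-k-subset (half i) (subst (k ≤_) (sym (∣half∣≡t i)) k≤t)
                   in (A , ∣A∣≡k) , A⊆P
    ; T-nonempty = let (B , ∣B∣≡k , B⊆∁P) = ∃-k-subset (∁ (half i)) (subst (k ≤_) (sym ∣∁half∣≡t) k≤t)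
                   in (B , ∣B∣≡k) , cong not (⊆ᵇ∁⇒meets≡false B (half i) B⊆∁P)
    ; complete   = λ (A , _) (B , _) A⊆P ¬BP → ⊆ᵇ-¬meets⇒∩≡⊥ A B (half i) A⊆P (not-injective ¬BP)
    }
    where
    ∣∁half∣≡t : ∣ ∁ (half i) ∣ ≡ t
    ∣∁half∣≡t = trans (∣∁p∣≡n∸∣p∣ (half i)) (trans (cong (t + t ∸_) (∣half∣≡t i)) (m+n∸n≡m t t))

  halvesPartition : k ≤ t → IsDBicliquePartition d (I (t + t) k k) (length halves)
  halvesPartition k≤t = halfBiclique k≤t , λ (A , ∣A∣≡k) (B , ∣B∣≡k) → count-halves-between A B ∣A∣≡k ∣B∣≡k

  -- Points are the halves, and block l consists of the halves containing l.
  halvesCFF : CFFExists k k d (length halves) (t + t)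
  halvesCFF = blocks , λ L M L∩M≡⊥ ∣L∣≡k ∣M∣≡k → ≤-reflexive (sym (begin
    ∣ (⋂[ blocks ] L) ∖ (⋃[ blocks ] M) ∣                         ≡⟨ ∣⋂∖⋃∣≡count blocks L M ⟩
    count (λ i → L ⊆ᵇ blocksContaining blocks i ∧ not (M meets blocksContaining blocks i))
      ≡⟨ count-cong (λ i → cong (λ P → L ⊆ᵇ P ∧ not (M meets P)) (blocksContaining-blocks i)) ⟩
    count (λ i → L ⊆ᵇ half i ∧ not (M meets half i))              ≡⟨ count-halves-between L M ∣L∣≡k ∣M∣≡k L∩M≡⊥ ⟩
    d                                                            ∎))
    where
    open ≡-Reasoning
    blocks : Fin (t + t) → Subset (length halves)
    blocks l = tabulate (λ i → lookup (half i) l)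
    blocksContaining-blocks : ∀ i → blocksContaining blocks i ≡ half i
    blocksContaining-blocks i = trans (tabulate-cong (λ l → lookup∘tabulate (λ i → lookup (half i) l) i)) (tabulate∘lookup (half i))

partition⇒cover : ∀ {d G m} → IsDBicliquePartition d G m → IsDBicliqueCover d G m
partition⇒cover (ℬ , exact) = ℬ , λ u v uv → ≤-reflexive (sym (exact u v uv))

AllEqual : (k n d m : ℕ) → Set
AllEqual k n d m = (N[ k , k , d ] n ≡ m) × (bc[ d ] I n k k ≡ m) × (bp[ d ] I n k k ≡ m)

halves-optimal : ∀ k j → let t = k + j in AllEqual k (t + t) ((j + j) C j) ((t + t) C t)
halves-optimal k j =
    (subst (λ m → CFFExists k k d m (t + t)) length-halves halvesCFF
      , λ m cff → DisjointPairCover⇒[2t]Ct≤m (CFF⇒DisjointPairCover cff))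
  , (subst (IsDBicliqueCover d (I (t + t) k k)) length-halves (partition⇒cover (halvesPartition k≤t))
      , λ m cover → DisjointPairCover⇒[2t]Ct≤m (bicliqueCover⇒DisjointPairCover cover))
  , (subst (IsDBicliquePartition d (I (t + t) k k)) length-halves (halvesPartition k≤t)
      , λ m partition → DisjointPairCover⇒[2t]Ct≤m (bicliqueCover⇒DisjointPairCover (partition⇒cover partition)))
  where
  open HalfSets k j
  k≤t : k ≤ t
  k≤t = m≤m+n k j

theorem2p2 : (k t : ℕ) → 1 ≤ k → k ≤ t →
    (N[ k , k , ((2 * t ∸ 2 * k) C (t ∸ k)) ] (2 * t) ≡ ((2 * t) C t))
    × (bc[ (2 * t ∸ 2 * k) C (t ∸ k) ] I (2 * t) k k ≡ ((2 * t) C t))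
    × (bp[ (2 * t ∸ 2 * k) C (t ∸ k) ] I (2 * t) k k ≡ ((2 * t) C t))
theorem2p2 k t _ k≤t with m≤n⇒∃[o]m+o≡n k≤t
... | j , refl = subst₂ (λ n d → AllEqual k n d (n C t)) t+t≡2t d≡ (halves-optimal k j)
  where
  t+t≡2t : t + t ≡ 2 * t
  t+t≡2t = cong (t +_) (sym (+-identityʳ t))
  d≡ : (j + j) C j ≡ (2 * t ∸ 2 * k) C (t ∸ k)
  d≡ = cong₂ _C_ (sym (trans (cong (_∸ 2 * k) (regroup k j)) (m+n∸m≡n (2 * k) (j + j)))) (sym (m+n∸m≡n k j))
    where
    regroup : ∀ k j → 2 * (k + j) ≡ 2 * k + (j + j)
    regroup = solve-∀
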